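{- Let $n>3$ be an integer such that $p=4n-1$ is prime, and let $M=\lfloor n^2/p\rfloor$. Then \[\sum_{k=0}^{n}\left\lfloor\frac{k^2}{p}\right\rfloor+\sum_{k=1}^{n}\left\lfloor\frac{k^2-k+2-3n}{p}\right\rfloor=\frac{n(n-5)}{6}+M-\frac{1}{2p}\sum_{k=1}^{p-1}r_p(k^2).\]
   Context: For a positive integer $q$ and $x\in\mathbb{Z}$, $r_q(x)\in\{0,1,\dots,q-1\}$ denotes the remainder of $x$ upon division by $q$. -}

module Defs where

open import Data.Nat as ℕ using (ℕ; suc; NonZero)
open import Data.Integer as ℤ using (ℤ)
open import Data.Rational as ℚ using (ℚ)
open import Data.List using (List; map; upTo)
open import Data.Nat.ListAction using (sum)

⌊_/_⌋ : (x : ℤ) (q : ℕ) → .{{_ : NonZero q}} → ℤ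
⌊ x / q ⌋ = ℚ.floor (x ℚ./ q)

-- Σ_{k=a}^{b} f k over naturals (empty if b < a)
sumℤ : ℕ → ℕ → (ℕ → ℤ) → ℤ
sumℤ a b f = Data.List.foldr ℤ._+_ (ℤ.+ 0) (map (λ i → f (a ℕ.+ i)) (upTo (suc b ℕ.∸ a)))
  where import Data.List

sumℕ : ℕ → ℕ → (ℕ → ℕ) → ℕ
sumℕ a b f = sum (map (λ i → f (a ℕ.+ i)) (upTo (suc b ℕ.∸ a)))

r : (q : ℕ) → .{{_ : NonZero q}} → ℕ → ℕ
r q x = x ℕ.% q

toℚ : ℤ → ℚ
toℚ x = x ℚ./ 1

-- Put p = 4n − 1. For 1 ≤ k ≤ n the numerator k² − k + 2 − 3n equals (k² − k + n + 1) − p, and p never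
-- divides k² − k + n + 1: since 16n² ≡ 1 (mod p) this would make −1 a square modulo p, which is impossible
-- for any modulus ≡ 3 (mod 4). So the second sum is Σ ⌊(k² − k + n)/p⌋ − n. On the other side, k ↦ p − k
-- shows that the sum of the remainders is twice its first half, and in that half the substitution
-- k = 2n − 1 − j turns k² into j² + j + n modulo p. Writing every remainder as x − p⌊x/p⌋, the floors
-- cancel against the left-hand side and only the polynomial identity
-- 6 Σ_{i<n} ((i + 1)² + i² + i + n) = p n (n + 1) + 6n² remains.

module Submission where

open import Defs
open import Data.Nat as ℕ using (ℕ; NonZero; _<_)
open import Data.Nat.Primality using (Prime)
open import Data.Integer as ℤ using (ℤ)
open import Data.Rational as ℚ using (ℚ)
open import Relation.Binary.PropositionalEquality using (_≡_; refl; cong)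
open import Data.Nat.Properties using (*-suc)

module Sum where

  open import Data.Nat.Base using (zero; suc; _∸_; s≤s; z≤n)
  import Data.Nat.Properties as ℕ
  open import Data.Integer.Base using (+_; _+_; _-_; _*_)
  open import Data.Integer.Properties using (pos-+; pos-*; +-identityˡ; +-identityʳ; +-assoc; +-comm; *-zeroʳ; *-distribˡ-+; suc-*)
  open import Data.Integer.Tactic.RingSolver using (solve-∀)
  open import Data.List.Base using (map; applyUpTo; foldr)
  open import Function.Base using (_∘_)
  open import Relation.Binary.PropositionalEquality using (refl; sym; trans; cong; cong₂; module ≡-Reasoning)
  open ≡-Reasoning

  ∑ : ℕ → (ℕ → ℤ) → ℤ
  ∑ zero    f = + 0
  ∑ (suc n) f = f 0 + ∑ n (f ∘ suc)

  foldr-+-map-applyUpTo : ∀ n (f : ℕ → ℤ) (h : ℕ → ℕ) → foldr _+_ (+ 0) (map f (applyUpTo h n)) ≡ ∑ n (f ∘ h)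
  foldr-+-map-applyUpTo zero    f h = refl
  foldr-+-map-applyUpTo (suc n) f h = cong (_+_ (f (h 0))) (foldr-+-map-applyUpTo n f (h ∘ suc))

  sumℤ≡∑ : ∀ a b f → sumℤ a b f ≡ ∑ (suc b ∸ a) (λ i → f (a ℕ.+ i))
  sumℤ≡∑ a b f = foldr-+-map-applyUpTo (suc b ∸ a) (λ i → f (a ℕ.+ i)) (λ i → i)

  +-foldr-+-map-applyUpTo : ∀ n (f : ℕ → ℕ) (h : ℕ → ℕ) →
                            + foldr ℕ._+_ 0 (map f (applyUpTo h n)) ≡ ∑ n (λ i → + f (h i))
  +-foldr-+-map-applyUpTo zero    f h = refl
  +-foldr-+-map-applyUpTo (suc n) f h =
    trans (pos-+ (f (h 0)) _) (cong (_+_ (+ f (h 0))) (+-foldr-+-map-applyUpTo n f (h ∘ suc)))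

  sumℕ≡∑ : ∀ a b f → + sumℕ a b f ≡ ∑ (suc b ∸ a) (λ i → + f (a ℕ.+ i))
  sumℕ≡∑ a b f = +-foldr-+-map-applyUpTo (suc b ∸ a) (λ i → f (a ℕ.+ i)) (λ i → i)

  ∑-cong : ∀ n {f g : ℕ → ℤ} → (∀ i → i < n → f i ≡ g i) → ∑ n f ≡ ∑ n g
  ∑-cong zero    f≡g = refl
  ∑-cong (suc n) f≡g = cong₂ _+_ (f≡g 0 (s≤s z≤n)) (∑-cong n (λ i i<n → f≡g (suc i) (s≤s i<n)))

  ∑-suc : ∀ n f → ∑ (suc n) f ≡ ∑ n f + f n
  ∑-suc zero    f = trans (+-identityʳ (f 0)) (sym (+-identityˡ (f 0)))
  ∑-suc (suc n) f = trans (cong (_+_ (f 0)) (∑-suc n (f ∘ suc))) (sym (+-assoc (f 0) _ _))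

  ∑-split : ∀ a b f → ∑ (a ℕ.+ b) f ≡ ∑ a f + ∑ b (λ i → f (a ℕ.+ i))
  ∑-split zero    b f = sym (+-identityˡ _)
  ∑-split (suc a) b f = trans (cong (_+_ (f 0)) (∑-split a b (f ∘ suc))) (sym (+-assoc (f 0) _ _))

  ∑-distrib-+ : ∀ n f g → ∑ n (λ i → f i + g i) ≡ ∑ n f + ∑ n g
  ∑-distrib-+ zero    f g = refl
  ∑-distrib-+ (suc n) f g =
    trans (cong (_+_ (f 0 + g 0)) (∑-distrib-+ n (f ∘ suc) (g ∘ suc))) (interchange (f 0) (g 0) _ _)
    where
    interchange : ∀ a b c d → a + b + (c + d) ≡ a + c + (b + d)
    interchange = solve-∀

  ∑-distrib-- : ∀ n f g → ∑ n (λ i → f i - g i) ≡ ∑ n f - ∑ n g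
  ∑-distrib-- zero    f g = refl
  ∑-distrib-- (suc n) f g =
    trans (cong (_+_ (f 0 - g 0)) (∑-distrib-- n (f ∘ suc) (g ∘ suc))) (interchange (f 0) (g 0) _ _)
    where
    interchange : ∀ a b c d → a - b + (c - d) ≡ a + c - (b + d)
    interchange = solve-∀

  ∑-distribˡ-* : ∀ n c f → ∑ n (λ i → c * f i) ≡ c * ∑ n f
  ∑-distribˡ-* zero    c f = sym (*-zeroʳ c)
  ∑-distribˡ-* (suc n) c f =
    trans (cong (_+_ (c * f 0)) (∑-distribˡ-* n c (f ∘ suc))) (sym (*-distribˡ-+ c (f 0) _))

  ∑-const : ∀ n c → ∑ n (λ _ → c) ≡ + n * c
  ∑-const zero    c = refl
  ∑-const (suc n) c = trans (cong (_+_ c) (∑-const n c)) (sym (suc-* (+ n) c))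

  ∑-reverse : ∀ n f → ∑ n f ≡ ∑ n (λ i → f (n ∸ suc i))
  ∑-reverse zero    f = refl
  ∑-reverse (suc n) f = begin
    f 0 + ∑ n (f ∘ suc)                       ≡⟨ cong (_+_ (f 0)) (∑-reverse n (f ∘ suc)) ⟩
    f 0 + ∑ n (λ i → f (suc (n ∸ suc i)))     ≡⟨ +-comm (f 0) _ ⟩
    ∑ n (λ i → f (suc (n ∸ suc i))) + f 0     ≡⟨ cong₂ _+_ (∑-cong n (λ i i<n → cong f (sym (ℕ.+-∸-assoc 1 i<n))))
                                                            (cong f (sym (ℕ.n∸n≡0 n))) ⟩
    ∑ n (λ i → f (suc n ∸ suc i)) + f (suc n ∸ suc n)  ≡⟨ sym (∑-suc n (λ i → f (suc n ∸ suc i))) ⟩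
    ∑ (suc n) (λ i → f (suc n ∸ suc i))       ∎

  ∑-reflect : ∀ n f g → (∀ i j → suc (i ℕ.+ j) ≡ n → f i ≡ g j) → ∑ n f ≡ ∑ n g
  ∑-reflect n f g f≡g = trans (∑-reverse n f) (∑-cong n (λ j j<n →
    f≡g (n ∸ suc j) j (trans (sym (ℕ.+-suc (n ∸ suc j) j)) (ℕ.m∸n+n≡m j<n))))

  ∑-squares+pronics : ∀ c k → + 6 * ∑ k (λ i → + (suc i ℕ.* suc i) + + (i ℕ.* i ℕ.+ i ℕ.+ c))
                              ≡ + k * (+ 1 + + k) * (+ 4 * + k - + 1) + + 6 * (+ k * + c)
  ∑-squares+pronics c zero    = refl
  ∑-squares+pronics c (suc k) = begin
    + 6 * ∑ (suc k) t                                  ≡⟨ cong (+ 6 *_) (∑-suc k t) ⟩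
    + 6 * (∑ k t + t k)                                ≡⟨ *-distribˡ-+ (+ 6) (∑ k t) (t k) ⟩
    + 6 * ∑ k t + + 6 * t k                            ≡⟨ cong₂ (λ u v → u + + 6 * v) (∑-squares+pronics c k) (summand k) ⟩
    + k * (+ 1 + + k) * (+ 4 * + k - + 1) + + 6 * (+ k * + c)
      + + 6 * ((+ 1 + + k) * (+ 1 + + k) + (+ k * + k + + k + + c))   ≡⟨ step (+ k) (+ c) ⟩
    (+ 1 + + k) * (+ 1 + (+ 1 + + k)) * (+ 4 * (+ 1 + + k) - + 1) + + 6 * ((+ 1 + + k) * + c)   ∎
    where
    t : ℕ → ℤ
    t i = + (suc i ℕ.* suc i) + + (i ℕ.* i ℕ.+ i ℕ.+ c)
    summand : ∀ i → t i ≡ (+ 1 + + i) * (+ 1 + + i) + (+ i * + i + + i + + c)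
    summand i = cong₂ _+_ (pos-* (suc i) (suc i))
      (trans (pos-+ (i ℕ.* i ℕ.+ i) c) (cong (_+ + c) (trans (pos-+ (i ℕ.* i) i) (cong (_+ + i) (pos-* i i)))))
    step : ∀ K C → K * (+ 1 + K) * (+ 4 * K - + 1) + + 6 * (K * C) + + 6 * ((+ 1 + K) * (+ 1 + K) + (K * K + K + C))
                   ≡ (+ 1 + K) * (+ 1 + (+ 1 + K)) * (+ 4 * (+ 1 + K) - + 1) + + 6 * ((+ 1 + K) * C)
    step = solve-∀

module FloorDivision where

  open import Data.Nat.Base using (suc)
  open import Data.Integer.Base using (+_; -[1+_]; _+_; _-_; _*_; _≤_; _/ℕ_) renaming (_<_ to _<ℤ_; suc to sucℤ)
  open import Data.Integer.Properties
  open import Data.Integer.DivMod using (div-pos-is-/ℕ; [n/ℕd]*d≤n; n<s[n/ℕd]*d)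
  open import Data.Integer.Tactic.RingSolver using (solve-∀)
  open import Data.Rational.Base using (mkℚ; ↥_; ↧_; floor)
  open import Data.Rational.Properties using (↥-/; ↧-/)
  open import Relation.Binary.PropositionalEquality using (refl; sym; trans; cong; subst; module ≡-Reasoning)

  /ℕ-unique : ∀ {i k d} .{{_ : NonZero d}} → k * + d ≤ i → i <ℤ sucℤ k * + d → i /ℕ d ≡ k
  /ℕ-unique {i} {k} {d@(suc _)} kd≤i i<[1+k]d =
    ≤-antisym (xd<[1+y]d⇒x≤y (≤-<-trans ([n/ℕd]*d≤n i d) i<[1+k]d))
              (xd<[1+y]d⇒x≤y (≤-<-trans kd≤i (n<s[n/ℕd]*d i d)))
    where
    xd<[1+y]d⇒x≤y : ∀ {x y} → x * + d <ℤ sucℤ y * + d → x ≤ y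
    xd<[1+y]d⇒x≤y {x} {y} xd<[1+y]d =
      subst (x ≤_) (pred-suc y) (i<j⇒i≤pred[j] (*-cancelʳ-<-nonNeg {j = sucℤ y} (+ d) xd<[1+y]d))

  floor-of-scaled : ∀ P g {i d} .{{_ : NonZero d}} → ↥ P * g ≡ i → ↧ P * g ≡ + d → floor P ≡ i /ℕ d
  floor-of-scaled (mkℚ a b-1 _) (+ 0) {d = suc _} _ bg≡d with () ← trans (sym bg≡d) (*-zeroʳ (+ suc b-1))
  floor-of-scaled (mkℚ a b-1 _) -[1+ _ ] {d = suc _} _ ()
  floor-of-scaled (mkℚ a b-1 _) g@(+ suc _) {d = d} refl bg≡d = begin
    a ℤ./ + b       ≡⟨ div-pos-is-/ℕ a b ⟩
    a /ℕ b          ≡⟨ sym (/ℕ-unique lower upper) ⟩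
    (a * g) /ℕ d    ∎
    where
    open ≡-Reasoning
    b = suc b-1
    scale : ∀ q → q * + b * g ≡ q * + d
    scale q = trans (*-assoc q (+ b) g) (cong (q *_) bg≡d)
    lower : (a /ℕ b) * + d ≤ a * g
    lower = subst (_≤ a * g) (scale (a /ℕ b)) (*-monoʳ-≤-nonNeg g ([n/ℕd]*d≤n a b))
    upper : a * g <ℤ sucℤ (a /ℕ b) * + d
    upper = subst (a * g <ℤ_) (scale (sucℤ (a /ℕ b))) (*-monoʳ-<-pos g (n<s[n/ℕd]*d a b))

  ⌊/⌋≡/ℕ : ∀ i d .{{_ : NonZero d}} → ⌊ i / d ⌋ ≡ i /ℕ d
  ⌊/⌋≡/ℕ i d = floor-of-scaled (i ℚ./ d) _ (↥-/ i d) (↧-/ i d)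

  ⌊-/⌋≡⌊/⌋-1 : ∀ i d .{{_ : NonZero d}} → ⌊ i - + d / d ⌋ ≡ ⌊ i / d ⌋ - + 1
  ⌊-/⌋≡⌊/⌋-1 i d = trans (⌊/⌋≡/ℕ (i - + d) d) (trans (/ℕ-unique lower upper) (cong (_- + 1) (sym (⌊/⌋≡/ℕ i d))))
    where
    q = i /ℕ d
    shift-down : ∀ q D → (q - + 1) * D ≡ q * D - D
    shift-down = solve-∀
    shift-up : ∀ q D → (+ 1 + q) * D - D ≡ (+ 1 + (q - + 1)) * D
    shift-up = solve-∀
    lower : (q - + 1) * + d ≤ i - + d
    lower = subst (_≤ i - + d) (sym (shift-down q (+ d))) (+-monoˡ-≤ (ℤ.- + d) ([n/ℕd]*d≤n i d))
    upper : i - + d <ℤ sucℤ (q - + 1) * + d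
    upper = subst (i - + d <ℤ_) (shift-up q (+ d)) (+-monoˡ-< (ℤ.- + d) (n<s[n/ℕd]*d i d))

module NatDivision where

  open import Data.Nat.Base
  open import Data.Nat.Properties
  open import Data.Nat.DivMod
  open import Data.Nat.Divisibility
  open import Data.Nat.Tactic.RingSolver using (solve-∀)
  open import Relation.Nullary using (¬_)
  open import Relation.Binary.PropositionalEquality using (refl; sym; cong; cong₂; module ≡-Reasoning)
  open ≡-Reasoning

  suc-/-≡ : ∀ x {d} .{{_ : NonZero d}} → ¬ (d ∣ suc x) → suc x / d ≡ x / d
  suc-/-≡ x {d} d∤1+x = begin
    suc x / d                              ≡⟨ /-congˡ (cong suc (m≡m%n+[m/n]*n x d)) ⟩
    (suc (x % d) + x / d * d) / d          ≡⟨ +-distrib-/-∣ʳ (suc (x % d)) (n∣m*n (x / d)) ⟩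
    suc (x % d) / d + x / d * d / d        ≡⟨ cong₂ _+_ (m<n⇒m/n≡0 1+x%d<d) (m*n/n≡m (x / d) d) ⟩
    x / d                                  ∎
    where
    1+x%d<d : suc (x % d) < d
    1+x%d<d = ≤∧≢⇒< (m%n<n x d) (λ 1+x%d≡d → d∤1+x (divides (suc (x / d)) (begin
      suc x                        ≡⟨ cong suc (m≡m%n+[m/n]*n x d) ⟩
      suc (x % d) + x / d * d      ≡⟨ cong (_+ x / d * d) 1+x%d≡d ⟩
      suc (x / d) * d              ∎)))

  a+b≡d⇒a*a%d≡b*b%d : ∀ a b {d} .{{_ : NonZero d}} → a + b ≡ d → a * a % d ≡ b * b % d
  a+b≡d⇒a*a%d≡b*b%d a b refl = begin
    a * a % (a + b)                           ≡⟨ sym ([m+kn]%n≡m%n (a * a) (2 * b) (a + b)) ⟩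
    (a * a + 2 * b * (a + b)) % (a + b)       ≡⟨ cong (_% (a + b)) (square-shift a b) ⟩
    (b * b + (a + b) * (a + b)) % (a + b)     ≡⟨ [m+kn]%n≡m%n (b * b) (a + b) (a + b) ⟩
    b * b % (a + b)                           ∎
    where
    square-shift : ∀ a b → a * a + 2 * b * (a + b) ≡ b * b + (a + b) * (a + b)
    square-shift = solve-∀

module MinusOneNonResidue where

  open import Data.Nat.Base
  open import Data.Nat.Properties
  open import Data.Nat.DivMod
  open import Data.Nat.Divisibility
  open import Data.Nat.Induction using (<-rec)
  open import Data.Nat.Tactic.RingSolver using (solve-∀)
  open import Data.Product using (∃; _,_)
  open import Data.Sum using (_⊎_; inj₁; inj₂)
  open import Relation.Nullary using (¬_)
  open import Relation.Binary.PropositionalEquality using (refl; sym; trans; cong; cong₂; subst; module ≡-Reasoning)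

  even-or-odd : ∀ y → ∃ λ h → y ≡ 2 * h ⊎ y ≡ 1 + 2 * h
  even-or-odd zero = 0 , inj₁ refl
  even-or-odd (suc y) with even-or-odd y
  ... | h , inj₁ y≡2h   = h , inj₂ (cong suc y≡2h)
  ... | h , inj₂ y≡1+2h = suc h , inj₁ (trans (cong suc y≡1+2h) (sym (*-suc 2 h)))

  ∣x²+1⇒∣[x%M]²+1 : ∀ x M .{{_ : NonZero M}} → M ∣ x * x + 1 → M ∣ x % M * (x % M) + 1
  ∣x²+1⇒∣[x%M]²+1 x M M∣x²+1 = m%n≡0⇒n∣m _ M (begin
    (x % M * (x % M) + 1) % M            ≡⟨ %-distribˡ-+ (x % M * (x % M)) 1 M ⟩
    (x % M * (x % M) % M + 1 % M) % M    ≡⟨ cong (λ s → (s + 1 % M) % M) (sym (%-distribˡ-* x x M)) ⟩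
    (x * x % M + 1 % M) % M              ≡⟨ sym (%-distribˡ-+ (x * x) 1 M) ⟩
    (x * x + 1) % M                      ≡⟨ n∣m⇒m%n≡0 _ M M∣x²+1 ⟩
    0                                    ∎)
    where open ≡-Reasoning

  ∣y²+1⇒∣z²+1 : ∀ {y z M} → y + z ≡ M → M ∣ y * y + 1 → M ∣ z * z + 1
  ∣y²+1⇒∣z²+1 {y} {z} refl M∣y²+1 =
    ∣m+n∣m⇒∣n (subst (y + z ∣_) (square-shift y z) (∣m∣n⇒∣m+n (m∣m*n (y + z)) M∣y²+1)) (m∣m*n (2 * y))
    where
    square-shift : ∀ y z → (y + z) * (y + z) + (y * y + 1) ≡ (y + z) * (2 * y) + (z * z + 1)
    square-shift = solve-∀

  3*r%4≡1⇒r≡3 : ∀ r → r < 4 → 3 * r % 4 ≡ 1 → r ≡ 3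
  3*r%4≡1⇒r≡3 0 _ ()
  3*r%4≡1⇒r≡3 1 _ ()
  3*r%4≡1⇒r≡3 2 _ ()
  3*r%4≡1⇒r≡3 3 _ _ = refl
  3*r%4≡1⇒r≡3 (suc (suc (suc (suc _)))) (s≤s (s≤s (s≤s (s≤s ())))) _

  cofactor≡3+4s : ∀ t m h → t * (3 + 4 * m) ≡ 1 + 4 * h → t ≡ 3 + 4 * (t / 4)
  cofactor≡3+4s t m h t[3+4m]≡1+4h = trans (m≡m%n+[m/n]*n t 4) (cong₂ _+_ t%4≡3 (*-comm (t / 4) 4))
    where
    open ≡-Reasoning
    ρ = t % 4
    σ = t / 4
    expand : ∀ a b m → 3 * a + (a * m + b * (3 + 4 * m)) * 4 ≡ (a + b * 4) * (3 + 4 * m)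
    expand = solve-∀
    3r%4≡1 : 3 * ρ % 4 ≡ 1
    3r%4≡1 = begin
      3 * ρ % 4                                          ≡⟨ sym ([m+kn]%n≡m%n (3 * ρ) (ρ * m + σ * (3 + 4 * m)) 4) ⟩
      (3 * ρ + (ρ * m + σ * (3 + 4 * m)) * 4) % 4        ≡⟨ cong (_% 4) (expand ρ σ m) ⟩
      (ρ + σ * 4) * (3 + 4 * m) % 4                      ≡⟨ cong (λ u → u * (3 + 4 * m) % 4) (sym (m≡m%n+[m/n]*n t 4)) ⟩
      t * (3 + 4 * m) % 4                                ≡⟨ cong (_% 4) (trans t[3+4m]≡1+4h (cong (1 +_) (*-comm 4 h))) ⟩
      (1 + h * 4) % 4                                    ≡⟨ [m+kn]%n≡m%n 1 h 4 ⟩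
      1                                                  ∎
    t%4≡3 : ρ ≡ 3
    t%4≡3 = 3*r%4≡1⇒r≡3 ρ (m%n<n t 4) 3r%4≡1

  cofactor< : ∀ {t M} x → 0 < x → x < M → t * M ≡ x * x + 1 → t < M
  cofactor< {t} {M} x 0<x x<M tM≡x²+1 = *-cancelʳ-< M t M (begin-strict
    t * M                  ≡⟨ tM≡x²+1 ⟩
    x * x + 1              <⟨ m<m+n (x * x + 1) (<-≤-trans 0<x (m≤m+n x (x + 0))) ⟩
    x * x + 1 + 2 * x      ≡⟨ square-suc x ⟩
    suc x * suc x          ≤⟨ *-mono-≤ x<M x<M ⟩
    M * M                  ∎)
    where
    open ≤-Reasoning
    square-suc : ∀ x → x * x + 1 + 2 * x ≡ suc x * suc x
    square-suc = solve-∀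

  odd<3+4m⇒complement : ∀ h m → 1 + 2 * h < 3 + 4 * m → ∃ λ h′ → 1 + 2 * h + 2 * h′ ≡ 3 + 4 * m
  odd<3+4m⇒complement h m 1+2h<3+4m = 1 + 2 * m ∸ h , (begin
    1 + 2 * h + 2 * (1 + 2 * m ∸ h)     ≡⟨ double-sum h (1 + 2 * m ∸ h) ⟩
    1 + 2 * (h + (1 + 2 * m ∸ h))       ≡⟨ cong (λ u → 1 + 2 * u) (m+[n∸m]≡n (<⇒≤ h<1+2m)) ⟩
    1 + 2 * (1 + 2 * m)                 ≡⟨ cong suc (double-odd m) ⟩
    3 + 4 * m                           ∎)
    where
    open ≡-Reasoning
    double-sum : ∀ a b → 1 + 2 * a + 2 * b ≡ 1 + 2 * (a + b)
    double-sum = solve-∀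
    double-odd : ∀ m → 2 * (1 + 2 * m) ≡ 2 + 4 * m
    double-odd = solve-∀
    h<1+2m : h < 1 + 2 * m
    h<1+2m = *-cancelˡ-< 2 h (1 + 2 * m) (subst (2 * h <_) (sym (double-odd m)) (s<s⁻¹ 1+2h<3+4m))

  -- Infinite descent: a counterexample x² + 1 ≡ 0 (mod 3 + 4m) can be taken even and below 3 + 4m,
  -- and then its cofactor is a smaller modulus of the same shape.
  3+4m∤x²+1 : ∀ m x → ¬ (3 + 4 * m ∣ x * x + 1)
  3+4m∤x²+1 = <-rec (λ m → ∀ x → ¬ (3 + 4 * m ∣ x * x + 1)) descent
    where
    descent : ∀ m → (∀ {m′} → m′ < m → ∀ x → ¬ (3 + 4 * m′ ∣ x * x + 1)) → ∀ x → ¬ (3 + 4 * m ∣ x * x + 1)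
    descent m smaller x M∣x²+1 = no-root-below (x % M) (m%n<n x M) (∣x²+1⇒∣[x%M]²+1 x M M∣x²+1)
      where
      M = 3 + 4 * m

      no-even-root-below : ∀ h → 2 * h < M → ¬ (M ∣ 2 * h * (2 * h) + 1)
      no-even-root-below zero    _    M∣1 with () ← ∣1⇒≡1 M∣1
      no-even-root-below (suc h) y<M (divides t y²+1≡tM) =
        smaller s<m y (subst (_∣ y * y + 1) t≡3+4s (divides M (trans y²+1≡tM (*-comm t M))))
        where
        y = 2 * suc h
        square-even : ∀ h → 2 * h * (2 * h) + 1 ≡ 1 + 4 * (h * h)
        square-even = solve-∀
        s = t / 4
        t≡3+4s : t ≡ 3 + 4 * s
        t≡3+4s = cofactor≡3+4s t m (suc h * suc h) (trans (sym y²+1≡tM) (square-even (suc h)))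
        s<m : s < m
        s<m = *-cancelˡ-< 4 s m (+-cancelˡ-< 3 (4 * s) (4 * m)
                (subst (_< M) t≡3+4s (cofactor< y (s≤s z≤n) y<M (sym y²+1≡tM))))

      no-root-below : ∀ y → y < M → ¬ (M ∣ y * y + 1)
      no-root-below y y<M M∣y²+1 with even-or-odd y
      ... | h , inj₁ refl = no-even-root-below h y<M M∣y²+1
      ... | h , inj₂ refl with odd<3+4m⇒complement h m y<M
      ...   | h′ , y+2h′≡M =
        no-even-root-below h′ (subst (2 * h′ <_) y+2h′≡M (m<n+m (2 * h′) {1 + 2 * h} (s≤s z≤n)))
          (∣y²+1⇒∣z²+1 {1 + 2 * h} {2 * h′} y+2h′≡M M∣y²+1)

module ClearingDenominators where

  open import Data.Nat.Base using (suc)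
  open import Data.Integer.Base using (+_; _+_; _-_; _*_; -_)
  open import Data.Integer.Properties using (pos-*)
  open import Data.Integer.GCD using (gcd)
  open import Data.Integer.Tactic.RingSolver using (solve-∀)
  open import Data.Rational.Base using (↥_; ↧_; toℚᵘ)
  open import Data.Rational.Properties
    using (↥-/; ↧-/; ↥ᵘ-toℚᵘ; ↧ᵘ-toℚᵘ; toℚᵘ-injective; toℚᵘ-homo-+; toℚᵘ-homo‿-; toℚᵘ-homo-*)
  open import Data.Rational.Unnormalised.Base as ℚᵘ using (*≡*) renaming (_≃_ to _≃ᵘ_)
  open import Data.Rational.Unnormalised.Properties as ℚᵘ using (≃-sym; +-cong; -‿cong; *-cong; module ≃-Reasoning)
  open import Relation.Binary.PropositionalEquality using (sym; trans; cong; module ≡-Reasoning)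

  toℚᵘ-/ : ∀ i d .{{_ : NonZero d}} → toℚᵘ (i ℚ./ d) ≃ᵘ i ℚᵘ./ d
  toℚᵘ-/ i d@(suc _) = *≡* (begin
    ℚᵘ.↥ toℚᵘ P * + d        ≡⟨ cong (_* + d) (↥ᵘ-toℚᵘ P) ⟩
    ↥ P * + d                ≡⟨ cong (↥ P *_) (sym (↧-/ i d)) ⟩
    ↥ P * (↧ P * g)          ≡⟨ regroup (↥ P) (↧ P) g ⟩
    ↥ P * g * ↧ P            ≡⟨ cong (_* ↧ P) (↥-/ i d) ⟩
    i * ↧ P                  ≡⟨ cong (i *_) (sym (↧ᵘ-toℚᵘ P)) ⟩
    i * ℚᵘ.↧ toℚᵘ P          ∎)
    where
    open ≡-Reasoning
    P = i ℚ./ d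
    g = gcd i (+ d)
    regroup : ∀ a b c → a * (b * c) ≡ a * c * b
    regroup = solve-∀

  cross-multiply : ∀ x a M S k → + 6 * (+ suc k * x) ≡ + suc k * a + + 6 * (+ suc k * M) - + 3 * S →
                   x ℚᵘ./ 1 ≃ᵘ a ℚᵘ./ 6 ℚᵘ.+ M ℚᵘ./ 1 ℚᵘ.- (+ 1 ℚᵘ./ 2) ℚᵘ.* (S ℚᵘ./ suc k)
  cross-multiply x a M S k 6dx≡ = *≡* (begin
    x * + (6 ℕ.* (2 ℕ.* d))                                 ≡⟨ cong (x *_) (trans (pos-* 6 (2 ℕ.* d)) (cong (+ 6 *_) (pos-* 2 d))) ⟩
    x * (+ 6 * (+ 2 * D))                                   ≡⟨ lhs-form x D ⟩
    + 2 * (+ 6 * (D * x))                                   ≡⟨ cong (+ 2 *_) 6dx≡ ⟩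
    + 2 * (D * a + + 6 * (D * M) - + 3 * S)                 ≡⟨ rhs-form a M S D ⟩
    ((a * + 1 + M * + 6) * (+ 2 * D) + - (+ 1 * S) * + 6) * + 1
      ≡⟨ cong (λ e → ((a * + 1 + M * + 6) * e + - (+ 1 * S) * + 6) * + 1) (sym (pos-* 2 d)) ⟩
    ((a * + 1 + M * + 6) * + (2 ℕ.* d) + - (+ 1 * S) * + 6) * + 1 ∎)
    where
    open ≡-Reasoning
    d = suc k
    D = + d
    lhs-form : ∀ x D → x * (+ 6 * (+ 2 * D)) ≡ + 2 * (+ 6 * (D * x))
    lhs-form = solve-∀
    rhs-form : ∀ a M S D → + 2 * (D * a + + 6 * (D * M) - + 3 * S)
                           ≡ ((a * + 1 + M * + 6) * (+ 2 * D) + - (+ 1 * S) * + 6) * + 1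
    rhs-form = solve-∀

  toℚ-cleared : ∀ x a M S d .{{_ : NonZero d}} → + 6 * (+ d * x) ≡ + d * a + + 6 * (+ d * M) - + 3 * S →
                toℚ x ≡ a ℚ./ 6 ℚ.+ toℚ M ℚ.- (+ 1 ℚ./ 2) ℚ.* (S ℚ./ d)
  toℚ-cleared x a M S d@(suc k) 6dx≡ = toℚᵘ-injective (≃-sym (begin
    toℚᵘ (a ℚ./ 6 ℚ.+ toℚ M ℚ.- ½ ℚ.* (S ℚ./ d))
      ≈⟨ toℚᵘ-homo-+ (a ℚ./ 6 ℚ.+ toℚ M) (ℚ.- (½ ℚ.* (S ℚ./ d))) ⟩
    toℚᵘ (a ℚ./ 6 ℚ.+ toℚ M) ℚᵘ.+ toℚᵘ (ℚ.- (½ ℚ.* (S ℚ./ d)))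
      ≈⟨ +-cong (toℚᵘ-homo-+ (a ℚ./ 6) (toℚ M))
                (ℚᵘ.≃-trans (toℚᵘ-homo‿- (½ ℚ.* (S ℚ./ d))) (-‿cong (toℚᵘ-homo-* ½ (S ℚ./ d)))) ⟩
    toℚᵘ (a ℚ./ 6) ℚᵘ.+ toℚᵘ (toℚ M) ℚᵘ.- toℚᵘ ½ ℚᵘ.* toℚᵘ (S ℚ./ d)
      ≈⟨ +-cong (+-cong (toℚᵘ-/ a 6) (toℚᵘ-/ M 1)) (-‿cong (*-cong (toℚᵘ-/ (+ 1) 2) (toℚᵘ-/ S d))) ⟩
    a ℚᵘ./ 6 ℚᵘ.+ M ℚᵘ./ 1 ℚᵘ.- (+ 1 ℚᵘ./ 2) ℚᵘ.* (S ℚᵘ./ d)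
      ≈⟨ ≃-sym (cross-multiply x a M S k 6dx≡) ⟩
    x ℚᵘ./ 1
      ≈⟨ ≃-sym (toℚᵘ-/ x 1) ⟩
    toℚᵘ (toℚ x) ∎))
    where
    open ≃-Reasoning
    ½ = + 1 ℚ./ 2

module FloorSums (m : ℕ) where

  open import Data.Nat.Base using (suc; _∸_)
  open import Data.Nat.DivMod using (_/_; _%_; [m+kn]%n≡m%n)
  open import Data.Nat.Divisibility using (_∣_; ∣m+n∣m⇒∣n; ∣n⇒∣m*n; m∣m*n)
  import Data.Nat.Tactic.RingSolver as ℕ-Solver
  open import Function.Base using (_∘_)
  open import Data.Integer.Base using (+_; _+_; _-_; _*_)
  open import Data.Integer.Properties using (pos-+; pos-*; *-comm; +-identityˡ; *-identityʳ)
  open import Data.Integer.DivMod using (a≡a%ℕn+[a/ℕn]*n)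
  open import Data.Integer.Tactic.RingSolver using (solve-∀)
  open import Relation.Nullary using (¬_)
  open import Relation.Binary.PropositionalEquality using (refl; sym; trans; cong; cong₂; subst; module ≡-Reasoning)
  open ≡-Reasoning
  open Sum
  open FloorDivision
  open NatDivision
  open MinusOneNonResidue

  n p : ℕ
  n = suc m
  p = 3 ℕ.+ 4 ℕ.* m

  X : ℕ → ℕ
  X i = i ℕ.* i ℕ.+ i ℕ.+ n

  quo rem : ℕ → ℤ
  quo x = + (x / p)
  rem x = + r p x

  P N : ℤ
  P = + p
  N = + n

  Sq Sx A C M : ℤ
  Sq = ∑ n (λ i → + (suc i ℕ.* suc i))
  Sx = ∑ n (λ i → + X i)
  A  = ∑ n (λ i → quo (suc i ℕ.* suc i))
  C  = ∑ n (quo ∘ X)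
  M  = quo (n ℕ.* n)

  rem≡ : ∀ x → rem x ≡ + x - P * quo x
  rem≡ x = begin
    rem x                              ≡⟨ sym (cancel (rem x) (quo x * P)) ⟩
    rem x + quo x * P - quo x * P      ≡⟨ cong (λ y → y - quo x * P) (sym (a≡a%ℕn+[a/ℕn]*n (+ x) p)) ⟩
    + x - quo x * P                    ≡⟨ cong (+ x -_) (*-comm (quo x) P) ⟩
    + x - P * quo x                    ∎
    where
    cancel : ∀ a b → a + b - b ≡ a
    cancel = solve-∀

  ∑-rem : ∀ k (h : ℕ → ℕ) → ∑ k (λ i → rem (h i)) ≡ ∑ k (λ i → + h i) - P * ∑ k (λ i → quo (h i))
  ∑-rem k h = begin
    ∑ k (λ i → rem (h i))                              ≡⟨ ∑-cong k {λ i → rem (h i)} (λ i _ → rem≡ (h i)) ⟩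
    ∑ k (λ i → + h i - P * quo (h i))                  ≡⟨ ∑-distrib-- k (λ i → + h i) (λ i → P * quo (h i)) ⟩
    ∑ k (λ i → + h i) - ∑ k (λ i → P * quo (h i))      ≡⟨ cong (∑ k (λ i → + h i) -_) (∑-distribˡ-* k P (λ i → quo (h i))) ⟩
    ∑ k (λ i → + h i) - P * ∑ k (λ i → quo (h i))      ∎

  p∤1+X : ∀ i → ¬ (p ∣ suc (X i))
  p∤1+X i p∣1+Xi = 3+4m∤x²+1 m x
    (∣m+n∣m⇒∣n (subst (p ∣_) (identity m i) (∣n⇒∣m*n (16 ℕ.* (n ℕ.* n)) p∣1+Xi))
      (m∣m*n ((2 ℕ.* n ℕ.+ 1) ℕ.* (2 ℕ.* n ℕ.+ 1))))
    where
    x = 2 ℕ.* n ℕ.* (2 ℕ.* i ℕ.+ 1)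
    identity : ∀ m i → let n = suc m in
      16 ℕ.* (n ℕ.* n) ℕ.* suc (i ℕ.* i ℕ.+ i ℕ.+ n)
      ≡ (3 ℕ.+ 4 ℕ.* m) ℕ.* ((2 ℕ.* n ℕ.+ 1) ℕ.* (2 ℕ.* n ℕ.+ 1))
        ℕ.+ ((2 ℕ.* n ℕ.* (2 ℕ.* i ℕ.+ 1)) ℕ.* (2 ℕ.* n ℕ.* (2 ℕ.* i ℕ.+ 1)) ℕ.+ 1)
    identity = ℕ-Solver.solve-∀

  +a-+b≡+c-+d : ∀ a b c d → a ℕ.+ d ≡ c ℕ.+ b → + a - + b ≡ + c - + d
  +a-+b≡+c-+d a b c d a+d≡c+b = begin
    + a - + b                   ≡⟨ pad (+ a) (+ b) (+ d) ⟩
    + a + + d - (+ b + + d)     ≡⟨ cong (_- (+ b + + d)) (trans (sym (pos-+ a d)) (trans (cong +_ a+d≡c+b) (pos-+ c b))) ⟩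
    + c + + b - (+ b + + d)     ≡⟨ unpad (+ c) (+ b) (+ d) ⟩
    + c - + d                   ∎
    where
    pad : ∀ a b d → a - b ≡ a + d - (b + d)
    pad = solve-∀
    unpad : ∀ c b d → c + b - (b + d) ≡ c - d
    unpad = solve-∀

  ⌊k²/p⌋ ⌊k²-k+2-3n/p⌋ : ℕ → ℤ
  ⌊k²/p⌋ k = ⌊ + (k ℕ.* k) / p ⌋
  ⌊k²-k+2-3n/p⌋ k = ⌊ + (k ℕ.* k) - + k + + 2 - + (3 ℕ.* n) / p ⌋

  ⌊k²-k+2-3n/p⌋≡ : ∀ i → ⌊k²-k+2-3n/p⌋ (suc i) ≡ quo (X i) - + 1
  ⌊k²-k+2-3n/p⌋≡ i = begin
    ⌊ + (k ℕ.* k) - + k + + 2 - + (3 ℕ.* n) / p ⌋     ≡⟨ cong ⌊_/ p ⌋ numerator ⟩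
    ⌊ + suc (X i) - + p / p ⌋                         ≡⟨ ⌊-/⌋≡⌊/⌋-1 (+ suc (X i)) p ⟩
    ⌊ + suc (X i) / p ⌋ - + 1                         ≡⟨ cong (_- + 1) (⌊/⌋≡/ℕ (+ suc (X i)) p) ⟩
    + (suc (X i) / p) - + 1                           ≡⟨ cong (λ q → + q - + 1) (suc-/-≡ (X i) (p∤1+X i)) ⟩
    quo (X i) - + 1                                   ∎
    where
    k = suc i
    regroup : ∀ a b c → a - b + + 2 - c ≡ a + + 2 - (b + c)
    regroup = solve-∀
    balance : ∀ i m → (suc i ℕ.* suc i ℕ.+ 2) ℕ.+ (3 ℕ.+ 4 ℕ.* m)
                      ≡ suc (i ℕ.* i ℕ.+ i ℕ.+ suc m) ℕ.+ (suc i ℕ.+ 3 ℕ.* suc m)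
    balance = ℕ-Solver.solve-∀
    numerator : + (k ℕ.* k) - + k + + 2 - + (3 ℕ.* n) ≡ + suc (X i) - + p
    numerator = begin
      + (k ℕ.* k) - + k + + 2 - + (3 ℕ.* n)           ≡⟨ regroup (+ (k ℕ.* k)) (+ k) (+ (3 ℕ.* n)) ⟩
      + (k ℕ.* k) + + 2 - (+ k + + (3 ℕ.* n))         ≡⟨ cong₂ _-_ (sym (pos-+ (k ℕ.* k) 2)) (sym (pos-+ k (3 ℕ.* n))) ⟩
      + (k ℕ.* k ℕ.+ 2) - + (k ℕ.+ 3 ℕ.* n)           ≡⟨ +a-+b≡+c-+d (k ℕ.* k ℕ.+ 2) (k ℕ.+ 3 ℕ.* n) (suc (X i)) p (balance i m) ⟩
      + suc (X i) - + p                               ∎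

  lhs≡ : sumℤ 0 n ⌊k²/p⌋ + sumℤ 1 n ⌊k²-k+2-3n/p⌋ ≡ A + (C - N)
  lhs≡ = cong₂ _+_
    (begin
      sumℤ 0 n ⌊k²/p⌋                                ≡⟨ sumℤ≡∑ 0 n ⌊k²/p⌋ ⟩
      ⌊k²/p⌋ 0 + ∑ n (⌊k²/p⌋ ∘ suc)                  ≡⟨ cong₂ _+_ (⌊/⌋≡/ℕ (+ 0) p) (∑-cong n (λ i _ → ⌊/⌋≡/ℕ (+ (suc i ℕ.* suc i)) p)) ⟩
      + 0 + ∑ n (λ i → quo (suc i ℕ.* suc i))        ≡⟨ +-identityˡ _ ⟩
      ∑ n (λ i → quo (suc i ℕ.* suc i))              ∎)
    (begin
      sumℤ 1 n ⌊k²-k+2-3n/p⌋               ≡⟨ sumℤ≡∑ 1 n ⌊k²-k+2-3n/p⌋ ⟩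
      ∑ n (⌊k²-k+2-3n/p⌋ ∘ suc)            ≡⟨ ∑-cong n (λ i _ → ⌊k²-k+2-3n/p⌋≡ i) ⟩
      ∑ n (λ i → quo (X i) - + 1)          ≡⟨ ∑-distrib-- n (quo ∘ X) (λ _ → + 1) ⟩
      ∑ n (quo ∘ X) - ∑ n (λ _ → + 1)      ≡⟨ cong (∑ n (quo ∘ X) -_) (trans (∑-const n (+ 1)) (*-identityʳ N)) ⟩
      ∑ n (quo ∘ X) - N                    ∎)

  rem-sq : ℕ → ℤ
  rem-sq i = rem (suc i ℕ.* suc i)

  w : ℕ
  w = n ℕ.+ m

  S : ℕ
  S = sumℕ 1 (p ∸ 1) (λ k → r p (k ℕ.* k))

  T : ℤ
  T = ∑ w rem-sq

  S≡T+T : + S ≡ T + T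
  S≡T+T = begin
    + S                                          ≡⟨ sumℕ≡∑ 1 (p ∸ 1) (λ k → r p (k ℕ.* k)) ⟩
    ∑ (p ∸ 1) rem-sq                             ≡⟨ cong (λ l → ∑ l rem-sq) (halves m) ⟩
    ∑ (w ℕ.+ w) rem-sq                           ≡⟨ ∑-split w w rem-sq ⟩
    ∑ w rem-sq + ∑ w (λ i → rem-sq (w ℕ.+ i))    ≡⟨ cong (_+_ (∑ w rem-sq)) (∑-reflect w (λ i → rem-sq (w ℕ.+ i)) rem-sq complement) ⟩
    ∑ w rem-sq + ∑ w rem-sq                      ∎
    where
    halves : ∀ m → 2 ℕ.+ 4 ℕ.* m ≡ (suc m ℕ.+ m) ℕ.+ (suc m ℕ.+ m)
    halves = ℕ-Solver.solve-∀
    shift : ∀ w i j → suc (w ℕ.+ i) ℕ.+ suc j ≡ suc (w ℕ.+ suc (i ℕ.+ j))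
    shift = ℕ-Solver.solve-∀
    whole : ∀ m → suc ((suc m ℕ.+ m) ℕ.+ (suc m ℕ.+ m)) ≡ 3 ℕ.+ 4 ℕ.* m
    whole = ℕ-Solver.solve-∀
    complement : ∀ i j → suc (i ℕ.+ j) ≡ w → rem-sq (w ℕ.+ i) ≡ rem-sq j
    complement i j 1+i+j≡w =
      cong +_ (a+b≡d⇒a*a%d≡b*b%d (suc (w ℕ.+ i)) (suc j)
        (trans (shift w i j) (trans (cong (λ v → suc (w ℕ.+ v)) 1+i+j≡w) (whole m))))

  square-of-middle : ∀ {m′} i j → suc (i ℕ.+ j) ≡ m′ →
                     suc (suc m′ ℕ.+ i) ℕ.* suc (suc m′ ℕ.+ i) ≡ (j ℕ.* j ℕ.+ j ℕ.+ suc m′) ℕ.+ suc i ℕ.* (3 ℕ.+ 4 ℕ.* m′)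
  square-of-middle i j refl = identity i j
    where
    identity : ∀ i j → let m′ = suc (i ℕ.+ j) in
               suc (suc m′ ℕ.+ i) ℕ.* suc (suc m′ ℕ.+ i) ≡ (j ℕ.* j ℕ.+ j ℕ.+ suc m′) ℕ.+ suc i ℕ.* (3 ℕ.+ 4 ℕ.* m′)
    identity = ℕ-Solver.solve-∀

  T≡ : T ≡ (Sq - P * A) + ((Sx - P * C) - (N * N - P * M))
  T≡ = begin
    ∑ (n ℕ.+ m) rem-sq                                   ≡⟨ ∑-split n m rem-sq ⟩
    ∑ n rem-sq + ∑ m (λ i → rem-sq (n ℕ.+ i))            ≡⟨ cong (_+_ (∑ n rem-sq)) (∑-reflect m _ (rem ∘ X) mirror) ⟩
    ∑ n rem-sq + ∑ m (rem ∘ X)                           ≡⟨ cong (_+_ (∑ n rem-sq)) drop-last ⟩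
    ∑ n rem-sq + (∑ n (rem ∘ X) - rem (n ℕ.* n))
      ≡⟨ cong₂ (λ u v → u + (v - rem (n ℕ.* n))) (∑-rem n (λ i → suc i ℕ.* suc i)) (∑-rem n X) ⟩
    (Sq - P * A) + ((Sx - P * C) - rem (n ℕ.* n))
      ≡⟨ cong (λ v → (Sq - P * A) + ((Sx - P * C) - v)) (trans (rem≡ (n ℕ.* n)) (cong (_- P * M) (pos-* n n))) ⟩
    (Sq - P * A) + ((Sx - P * C) - (N * N - P * M))      ∎
    where
    mirror : ∀ i j → suc (i ℕ.+ j) ≡ m → rem-sq (n ℕ.+ i) ≡ rem (X j)
    mirror i j 1+i+j≡m = cong +_ (trans (cong (_% p) (square-of-middle i j 1+i+j≡m)) ([m+kn]%n≡m%n (X j) (suc i) p))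
    Xm≡n² : ∀ m → m ℕ.* m ℕ.+ m ℕ.+ suc m ≡ suc m ℕ.* suc m
    Xm≡n² = ℕ-Solver.solve-∀
    cancel : ∀ a b → a ≡ a + b - b
    cancel = solve-∀
    drop-last : ∑ m (rem ∘ X) ≡ ∑ n (rem ∘ X) - rem (n ℕ.* n)
    drop-last = begin
      ∑ m (rem ∘ X)                          ≡⟨ cancel _ (rem (X m)) ⟩
      ∑ m (rem ∘ X) + rem (X m) - rem (X m)  ≡⟨ cong₂ _-_ (sym (∑-suc m (rem ∘ X))) (cong rem (Xm≡n² m)) ⟩
      ∑ n (rem ∘ X) - rem (n ℕ.* n)          ∎

  6[Sq+Sx]≡ : + 6 * (Sq + Sx) ≡ P * (N * (+ 1 + N)) + + 6 * (N * N)
  6[Sq+Sx]≡ = begin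
    + 6 * (Sq + Sx)                                       ≡⟨ cong (+ 6 *_) (sym (∑-distrib-+ n (λ i → + (suc i ℕ.* suc i)) (λ i → + X i))) ⟩
    + 6 * ∑ n (λ i → + (suc i ℕ.* suc i) + + X i)         ≡⟨ ∑-squares+pronics n n ⟩
    N * (+ 1 + N) * (+ 4 * N - + 1) + + 6 * (N * N)       ≡⟨ reorder N ⟩
    (+ 4 * N - + 1) * (N * (+ 1 + N)) + + 6 * (N * N)     ≡⟨ cong (λ q → q * (N * (+ 1 + N)) + + 6 * (N * N)) (sym P≡4N-1) ⟩
    P * (N * (+ 1 + N)) + + 6 * (N * N)                   ∎
    where
    reorder : ∀ N → N * (+ 1 + N) * (+ 4 * N - + 1) + + 6 * (N * N) ≡ (+ 4 * N - + 1) * (N * (+ 1 + N)) + + 6 * (N * N)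
    reorder = solve-∀
    shift : ∀ m → + 3 + + 4 * m ≡ + 4 * (+ 1 + m) - + 1
    shift = solve-∀
    P≡4N-1 : P ≡ + 4 * N - + 1
    P≡4N-1 = trans (cong (_+_ (+ 3)) (pos-* 4 m)) (shift (+ m))

  6p·lhs≡ : + 6 * (P * (sumℤ 0 n ⌊k²/p⌋ + sumℤ 1 n ⌊k²-k+2-3n/p⌋))
            ≡ P * (+ (n ℕ.* n) - + (5 ℕ.* n)) + + 6 * (P * ⌊k²/p⌋ n) - + 3 * + S
  6p·lhs≡ = begin
    + 6 * (P * (sumℤ 0 n ⌊k²/p⌋ + sumℤ 1 n ⌊k²-k+2-3n/p⌋))    ≡⟨ cong (λ l → + 6 * (P * l)) lhs≡ ⟩
    + 6 * (P * (A + (C - N)))                                 ≡⟨ balance P N A C M Sq Sx ⟩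
    E + (+ 6 * (Sq + Sx) - Y)                                 ≡⟨ cong (λ s → E + (s - Y)) 6[Sq+Sx]≡ ⟩
    E + (Y - Y)                                               ≡⟨ +-inverse-cancel E Y ⟩
    P * (N * N - + 5 * N) + + 6 * (P * M) - + 3 * (T′ + T′)
      ≡⟨ cong (λ a → P * a + + 6 * (P * M) - + 3 * (T′ + T′)) (cong₂ _-_ (sym (pos-* n n)) (sym (pos-* 5 n))) ⟩
    P * (+ (n ℕ.* n) - + (5 ℕ.* n)) + + 6 * (P * M) - + 3 * (T′ + T′)
      ≡⟨ cong₂ (λ b s → P * (+ (n ℕ.* n) - + (5 ℕ.* n)) + + 6 * (P * b) - + 3 * s)
               (sym (⌊/⌋≡/ℕ (+ (n ℕ.* n)) p)) (sym (trans S≡T+T (cong₂ _+_ T≡ T≡))) ⟩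
    P * (+ (n ℕ.* n) - + (5 ℕ.* n)) + + 6 * (P * ⌊k²/p⌋ n) - + 3 * + S   ∎
    where
    T′ = (Sq - P * A) + ((Sx - P * C) - (N * N - P * M))
    E = P * (N * N - + 5 * N) + + 6 * (P * M) - + 3 * (T′ + T′)
    Y = P * (N * (+ 1 + N)) + + 6 * (N * N)
    balance : ∀ P N A C M Sq Sx → let T′ = (Sq - P * A) + ((Sx - P * C) - (N * N - P * M)) in
      + 6 * (P * (A + (C - N)))
      ≡ P * (N * N - + 5 * N) + + 6 * (P * M) - + 3 * (T′ + T′) + (+ 6 * (Sq + Sx) - (P * (N * (+ 1 + N)) + + 6 * (N * N)))
    balance = solve-∀
    +-inverse-cancel : ∀ a b → a + (b - b) ≡ a
    +-inverse-cancel = solve-∀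

FloorSumIdentity : (n d : ℕ) .{{_ : NonZero d}} → Set
FloorSumIdentity n d =
  toℚ (sumℤ 0 n (λ k → ⌊ ℤ.+ (k ℕ.* k) / d ⌋)
       ℤ.+ sumℤ 1 n (λ k → ⌊ (ℤ.+ (k ℕ.* k) ℤ.- ℤ.+ k ℤ.+ ℤ.+ 2 ℤ.- ℤ.+ (3 ℕ.* n)) / d ⌋))
  ≡ (ℤ.+ (n ℕ.* n) ℤ.- ℤ.+ (5 ℕ.* n)) ℚ./ 6
    ℚ.+ toℚ ⌊ ℤ.+ (n ℕ.* n) / d ⌋
    ℚ.- (ℤ.+ 1 ℚ./ 2) ℚ.* (ℤ.+ (sumℕ 1 (d ℕ.∸ 1) (λ k → r d (k ℕ.* k))) ℚ./ d)

-- The modulus is kept as a variable d so that matching d ≡ 3 + 4m against refl turns 4n ∸ 1 into 3 + 4m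
-- without disturbing the instance argument.
floorSumIdentity : ∀ m d .{{_ : NonZero d}} → d ≡ 3 ℕ.+ 4 ℕ.* m → FloorSumIdentity (ℕ.suc m) d
floorSumIdentity m _ refl =
  toℚ-cleared (sumℤ 0 n ⌊k²/p⌋ ℤ.+ sumℤ 1 n ⌊k²-k+2-3n/p⌋) (ℤ.+ (n ℕ.* n) ℤ.- ℤ.+ (5 ℕ.* n)) (⌊k²/p⌋ n) (ℤ.+ S) p
    6p·lhs≡
  where
  open ClearingDenominators using (toℚ-cleared)
  open FloorSums m

corollary5p7 : (n : ℕ) → 3 < n → Prime (4 ℕ.* n ℕ.∸ 1) → {{_ : NonZero (4 ℕ.* n ℕ.∸ 1)}} →
  toℚ (sumℤ 0 n (λ k → ⌊ ℤ.+ (k ℕ.* k) / (4 ℕ.* n ℕ.∸ 1) ⌋)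
           ℤ.+ sumℤ 1 n (λ k → ⌊ (ℤ.+ (k ℕ.* k) ℤ.- ℤ.+ k ℤ.+ ℤ.+ 2 ℤ.- ℤ.+ (3 ℕ.* n)) / (4 ℕ.* n ℕ.∸ 1) ⌋))
  ≡ (ℤ.+ (n ℕ.* n) ℤ.- ℤ.+ (5 ℕ.* n)) ℚ./ 6
    ℚ.+ toℚ ⌊ ℤ.+ (n ℕ.* n) / (4 ℕ.* n ℕ.∸ 1) ⌋
    ℚ.- (ℤ.+ 1 ℚ./ 2) ℚ.* (ℤ.+ (sumℕ 1 ((4 ℕ.* n ℕ.∸ 1) ℕ.∸ 1) (λ k → r (4 ℕ.* n ℕ.∸ 1) (k ℕ.* k))) ℚ./ (4 ℕ.* n ℕ.∸ 1))
corollary5p7 (ℕ.suc m) _ _ = floorSumIdentity m (4 ℕ.* ℕ.suc m ℕ.∸ 1) (cong (ℕ._∸ 1) (*-suc 4 m))
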